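{- Let $d\ge1$. Then $$\sum_{\sigma\in \mathcal S_d^D}t^{\mathrm{Wmaj}(\sigma)}=\frac{(1-t)^d+(1+t)^d}{2}\prod_{j=1}^d\frac{1-t^j}{1-t}.$$
   Context: $\mathcal S_d^\pm$ is the group of permutations $\sigma$ of $\{\pm1,\dots,\pm d\}$ with $\sigma(-i)=-\sigma(i)$, and $\mathcal S_d^D$ is its subgroup of those $\sigma$ with $\prod_{i=1}^d\sigma(i)=d!$ (i.e. with an even number of $i\in\{1,\dots,d\}$ such that $\sigma(i)<0$). $\mathrm{Wmaj}(\sigma)=\sum_{1\le i<d,\ \sigma(i)>\sigma(i+1)}i+\#\{1\le i\le d:\sigma(i)<0\}$, using the usual order on integers. -}

module Defs where

open import Data.Nat as ℕ using (ℕ; zero; suc)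
open import Data.Nat using (_!)
open import Data.Integer as ℤ using (ℤ; +_; -_; ∣_∣; _<_; _*_; _+_; _^_)
open import Data.Integer.Properties using (_<?_; _≟_)
import Data.Nat.Properties as ℕP
open import Data.List using (List; []; _∷_; map; _++_; concatMap; filter; length; upTo)
import Data.List as L
open import Data.Product using (_×_)
open import Data.Bool using (if_then_else_)
open import Relation.Nullary using (does)
import Relation.Nullary
open import Relation.Nullary.Decidable using (_×-dec_)
open import Relation.Binary.PropositionalEquality using (_≡_)
open import Data.List.Relation.Unary.Unique.Propositional using (Unique)
import Data.List.Relation.Unary.Unique.DecPropositional as UD

range : ℕ → List ℕ
range d = map suc (upTo d)

signedVals : ℕ → List ℤ
signedVals d = map (λ k → - (+ k)) (range d) ++ map +_ (range d)

words : {A : Set} → ℕ → List A → List (List A)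
words zero    xs = [] ∷ []
words (suc n) xs = concatMap (λ x → map (x ∷_) (words n xs)) xs

-- A signed permutation σ of {±1,…,±d} (with σ(-i) = -σ(i)) is encoded by
-- its window [σ(1), …, σ(d)]: a word with letters in {±1,…,±d} whose
-- absolute values are pairwise distinct.
IsSignedPerm : List ℤ → Set
IsSignedPerm w = Unique (map ∣_∣ w)

-- Membership in S_d^D (for words already of length d with letters in ±[d]):
-- signed permutation with σ(1)⋯σ(d) = d!.
InTypeD : ℕ → List ℤ → Set
InTypeD d w = IsSignedPerm w × (L.foldr _*_ (+ 1) w ≡ + (d !))

inTypeD? : (d : ℕ) → (w : List ℤ) → Relation.Nullary.Dec (InTypeD d w)
inTypeD? d w = UD.unique? ℕP._≟_ (map ∣_∣ w) ×-dec (L.foldr _*_ (+ 1) w ≟ + (d !))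

typeD : ℕ → List (List ℤ)
typeD d = filter (inTypeD? d) (words d (signedVals d))

-- Sum of descent positions i (1 ≤ i < d, σ(i) > σ(i+1)); first argument is
-- the position of the head of the list.
desSum : ℕ → List ℤ → ℕ
desSum i (x ∷ y ∷ r) = (if does (y <? x) then i else 0) ℕ.+ desSum (suc i) (y ∷ r)
desSum i _           = 0

negCount : List ℤ → ℕ
negCount w = length (filter (λ x → x <? + 0) w)

Wmaj : List ℤ → ℕ
Wmaj w = desSum 1 w ℕ.+ negCount w

WmajGenD : ℕ → ℤ → ℤ
WmajGenD d t = L.foldr _+_ (+ 0) (map (λ w → t ^ Wmaj w) (typeD d))

-- q-integer [j]_t = (1 - t^j)/(1 - t) = 1 + t + … + t^{j-1}
qInt : ℕ → ℤ → ℤ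
qInt j t = L.foldr _+_ (+ 0) (map (t ^_) (upTo j))

qFact : ℕ → ℤ → ℤ
qFact d t = L.foldr _*_ (+ 1) (map (λ j → qInt j t) (range d))

module Submission where

-- Refine by a variable z for the sign statistic: over all signed permutations,
--   Σ_{σ ∈ S_d^±} t^maj(σ) z^neg(σ) = [d]_t! (1+z)^d                          (S-full).
-- Since Wmaj = maj + neg, evaluating at z = t and z = -t gives Σ t^Wmaj and
-- Σ (-1)^neg t^Wmaj; their sum counts S_d^D twice, because σ(1)⋯σ(d) = (-1)^neg d!
-- (inTypeD-sign, typeD-indicator).
--
-- S-full is proved by removing the last letter of the window. For this recursion to close
-- up, module Refined generalises to words over a set A of available absolute values that
-- also record whether the word ends above the letter that will follow it. The closed form
-- of this refinement depends only on the rank of that following letter in A (closed-form),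
-- and the resulting sums over ranks are the polynomial identities of module Identities.

open import Defs
open import Data.Nat using (ℕ; _≤_)
open import Data.Integer using (ℤ; +_; _+_; _-_; _*_; _^_)
open import Relation.Binary.PropositionalEquality using (_≡_)

open import Data.Nat as ℕ using (zero; suc; _<_; z≤n; s≤s; _∸_; _!)
import Data.Nat.Properties as ℕP
open import Data.Integer as ℤ using (-_; ∣_∣; -[1+_])
import Data.Integer.Properties as ℤP
open import Data.Integer.Tactic.RingSolver using (solve-∀)
open import Data.List using (List; []; _∷_; _++_; map; concatMap; filter; length; foldr; upTo)
import Data.List.Properties as LP
open import Data.List.Relation.Unary.All using (All; []; _∷_)
import Data.List.Relation.Unary.All
import Data.List.Relation.Unary.All.Properties as AllP
open import Data.List.Relation.Unary.Unique.Propositional using (Unique)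
import Data.List.Relation.Unary.Unique.DecPropositional as UD
open import Data.List.Relation.Unary.AllPairs using ([]; _∷_)
open import Data.List.Membership.Propositional using (_∈_)
open import Data.List.Membership.Propositional.Properties using (∈-++⁻; ∈-map⁻; ∈-upTo⁻)
open import Data.Sum using (inj₁; inj₂)
open import Data.List.Relation.Unary.Any using (here; there)
open import Data.Bool using (Bool; true; false; if_then_else_; _∧_; not)
import Data.Bool.Properties
open import Data.Product using (_×_; _,_; proj₁)
open import Data.Empty using (⊥-elim)
open import Relation.Nullary using (¬_; does; yes; no)
open import Relation.Binary.Definitions using (tri<; tri≈; tri>)
open import Relation.Nullary.Decidable using (Dec; dec-true; dec-false)
open import Relation.Binary.PropositionalEquality using (refl; sym; trans; cong; cong₂; subst; module ≡-Reasoning)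
open import Algebra.Properties.CommutativeSemigroup ℤP.+-commutativeSemigroup using (interchange)

∑ : {A : Set} → List A → (A → ℤ) → ℤ
∑ []       f = + 0
∑ (x ∷ xs) f = f x + ∑ xs f

∑-cong∈ : {A : Set} (xs : List A) {f g : A → ℤ} → (∀ x → x ∈ xs → f x ≡ g x) → ∑ xs f ≡ ∑ xs g
∑-cong∈ []       h = refl
∑-cong∈ (x ∷ xs) h = cong₂ _+_ (h x (here refl)) (∑-cong∈ xs (λ y y∈ → h y (there y∈)))

∑-cong : {A : Set} (xs : List A) {f g : A → ℤ} → (∀ x → f x ≡ g x) → ∑ xs f ≡ ∑ xs g
∑-cong xs h = ∑-cong∈ xs (λ x _ → h x)

∑-++ : {A : Set} (xs ys : List A) (f : A → ℤ) → ∑ (xs ++ ys) f ≡ ∑ xs f + ∑ ys f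
∑-++ []       ys f = sym (ℤP.+-identityˡ _)
∑-++ (x ∷ xs) ys f = trans (cong (_+_ (f x)) (∑-++ xs ys f)) (sym (ℤP.+-assoc (f x) _ _))

∑-map : {A B : Set} (g : A → B) (xs : List A) (f : B → ℤ) → ∑ (map g xs) f ≡ ∑ xs (λ x → f (g x))
∑-map g []       f = refl
∑-map g (x ∷ xs) f = cong (_+_ (f (g x))) (∑-map g xs f)

∑-concatMap : {A B : Set} (g : A → List B) (xs : List A) (f : B → ℤ) →
  ∑ (concatMap g xs) f ≡ ∑ xs (λ x → ∑ (g x) f)
∑-concatMap g []       f = refl
∑-concatMap g (x ∷ xs) f = trans (∑-++ (g x) (concatMap g xs) f) (cong (_+_ (∑ (g x) f)) (∑-concatMap g xs f))

∑-+ : {A : Set} (xs : List A) (f g : A → ℤ) → ∑ xs (λ x → f x + g x) ≡ ∑ xs f + ∑ xs g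
∑-+ []       f g = refl
∑-+ (x ∷ xs) f g = trans (cong (_+_ (f x + g x)) (∑-+ xs f g)) (interchange (f x) (g x) (∑ xs f) (∑ xs g))

∑-*ˡ : {A : Set} (xs : List A) (c : ℤ) (f : A → ℤ) → ∑ xs (λ x → c * f x) ≡ c * ∑ xs f
∑-*ˡ []       c f = sym (ℤP.*-zeroʳ c)
∑-*ˡ (x ∷ xs) c f = trans (cong (_+_ (c * f x)) (∑-*ˡ xs c f)) (sym (ℤP.*-distribˡ-+ c (f x) (∑ xs f)))

∑-zero : {A : Set} (xs : List A) → ∑ xs (λ _ → + 0) ≡ + 0
∑-zero []       = refl
∑-zero (x ∷ xs) = trans (ℤP.+-identityˡ _) (∑-zero xs)

∑-swap : {A B : Set} (xs : List A) (ys : List B) (f : A → B → ℤ) →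
  ∑ xs (λ x → ∑ ys (f x)) ≡ ∑ ys (λ y → ∑ xs (λ x → f x y))
∑-swap []       ys f = sym (∑-zero ys)
∑-swap (x ∷ xs) ys f =
  trans (cong (_+_ (∑ ys (f x))) (∑-swap xs ys f)) (sym (∑-+ ys (f x) (λ y → ∑ xs (λ x' → f x' y))))

foldr-map≡∑ : {A : Set} (xs : List A) (f : A → ℤ) → foldr _+_ (+ 0) (map f xs) ≡ ∑ xs f
foldr-map≡∑ []       f = refl
foldr-map≡∑ (x ∷ xs) f = cong (_+_ (f x)) (foldr-map≡∑ xs f)

∑-filter : {A : Set} {P : A → Set} (P? : (x : A) → Dec (P x)) (xs : List A) (f : A → ℤ) →
  ∑ (filter P? xs) f ≡ ∑ xs (λ x → if does (P? x) then f x else + 0)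
∑-filter P? []       f = refl
∑-filter P? (x ∷ xs) f with does (P? x)
... | true  = cong (_+_ (f x)) (∑-filter P? xs f)
... | false = trans (∑-filter P? xs f) (sym (ℤP.+-identityˡ _))

∑< : ℕ → (ℕ → ℤ) → ℤ
∑< zero    h = + 0
∑< (suc N) h = ∑< N h + h N

∑-upTo : (N : ℕ) (h : ℕ → ℤ) → ∑ (upTo N) h ≡ ∑< N h
∑-upTo zero    h = refl
∑-upTo (suc N) h = begin
  ∑ (upTo (suc N)) h           ≡⟨ cong (λ xs → ∑ xs h) (sym (LP.upTo-∷ʳ N)) ⟩
  ∑ (upTo N ++ N ∷ []) h       ≡⟨ ∑-++ (upTo N) (N ∷ []) h ⟩
  ∑ (upTo N) h + (h N + + 0)   ≡⟨ cong₂ _+_ (∑-upTo N h) (ℤP.+-identityʳ (h N)) ⟩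
  ∑< N h + h N                 ∎
  where open ≡-Reasoning

∑<-cong : ∀ N {f g : ℕ → ℤ} → (∀ j → j < N → f j ≡ g j) → ∑< N f ≡ ∑< N g
∑<-cong zero    h = refl
∑<-cong (suc N) h = cong₂ _+_ (∑<-cong N (λ j j<N → h j (ℕP.m<n⇒m<1+n j<N))) (h N (ℕP.n<1+n N))

∑<-+ : ∀ N (f g : ℕ → ℤ) → ∑< N (λ j → f j + g j) ≡ ∑< N f + ∑< N g
∑<-+ zero    f g = refl
∑<-+ (suc N) f g = trans (cong (_+ (f N + g N)) (∑<-+ N f g)) (interchange (∑< N f) (∑< N g) (f N) (g N))

∑<-*ˡ : ∀ N c (f : ℕ → ℤ) → ∑< N (λ j → c * f j) ≡ c * ∑< N f
∑<-*ˡ zero    c f = sym (ℤP.*-zeroʳ c)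
∑<-*ˡ (suc N) c f = trans (cong (_+ c * f N) (∑<-*ˡ N c f)) (sym (ℤP.*-distribˡ-+ c (∑< N f) (f N)))

∑<-shift : ∀ N (h : ℕ → ℤ) → ∑< (suc N) h ≡ h 0 + ∑< N (λ j → h (suc j))
∑<-shift zero    h = ℤP.+-comm (+ 0) (h 0)
∑<-shift (suc N) h = trans (cong (_+ h (suc N)) (∑<-shift N h)) (ℤP.+-assoc (h 0) _ _)

∑<-point : ∀ N α (f g : ℕ → ℤ) δ → α < N → (∀ j → j < N → ¬ j ≡ α → f j ≡ g j) → f α ≡ g α + δ →
  ∑< N f ≡ ∑< N g + δ
∑<-point (suc N) α f g δ α<1+N off at with ℕP.<-cmp α N
... | tri< α<N _ _ = begin
  ∑< N f + f N          ≡⟨ cong₂ _+_ (∑<-point N α f g δ α<N (λ j j<N → off j (ℕP.m<n⇒m<1+n j<N)) at)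
                                      (off N (ℕP.n<1+n N) (λ N≡α → ℕP.<-irrefl (sym N≡α) α<N)) ⟩
  ∑< N g + δ + g N      ≡⟨ swap₂₃ (∑< N g) δ (g N) ⟩
  ∑< N g + g N + δ      ∎
  where
  open ≡-Reasoning
  swap₂₃ : ∀ (a b c : ℤ) → a + b + c ≡ a + c + b
  swap₂₃ = solve-∀
... | tri≈ _ refl _ = begin
  ∑< N f + f N          ≡⟨ cong₂ _+_ (∑<-cong N (λ j j<N → off j (ℕP.m<n⇒m<1+n j<N) (λ j≡N → ℕP.<-irrefl j≡N j<N))) at ⟩
  ∑< N g + (g N + δ)    ≡⟨ sym (ℤP.+-assoc (∑< N g) (g N) δ) ⟩
  ∑< N g + g N + δ      ∎
  where open ≡-Reasoning
... | tri> _ _ N<α = ⊥-elim (ℕP.<-irrefl refl (ℕP.<-≤-trans N<α (ℕP.≤-pred α<1+N)))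

words-snoc : {A : Set} (n : ℕ) (xs : List A) (f : List A → ℤ) →
  ∑ (words (suc n) xs) f ≡ ∑ (words n xs) (λ r → ∑ xs (λ y → f (r ++ y ∷ [])))
words-snoc zero xs f =
  trans (∑-concatMap _ xs f) (trans (∑-cong xs (λ x → ℤP.+-identityʳ (f (x ∷ [])))) (sym (ℤP.+-identityʳ _)))
words-snoc (suc n) xs f = begin
  ∑ (words (suc (suc n)) xs) f
    ≡⟨ ∑-concatMap _ xs f ⟩
  ∑ xs (λ x → ∑ (map (x ∷_) (words (suc n) xs)) f)
    ≡⟨ ∑-cong xs (λ x → trans (∑-map (x ∷_) (words (suc n) xs) f) (words-snoc n xs (λ w → f (x ∷ w)))) ⟩
  ∑ xs (λ x → ∑ (words n xs) (λ r → ∑ xs (λ y → f (x ∷ r ++ y ∷ []))))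
    ≡⟨ sym (∑-cong xs (λ x → ∑-map (x ∷_) (words n xs) _)) ⟩
  ∑ xs (λ x → ∑ (map (x ∷_) (words n xs)) (λ r → ∑ xs (λ y → f (r ++ y ∷ []))))
    ≡⟨ sym (∑-concatMap _ xs _) ⟩
  ∑ (words (suc n) xs) (λ r → ∑ xs (λ y → f (r ++ y ∷ [])))
    ∎
  where open ≡-Reasoning

words-cong : {A : Set} (n : ℕ) (xs : List A) {f g : List A → ℤ} →
  (∀ w → length w ≡ n → All (_∈ xs) w → f w ≡ g w) → ∑ (words n xs) f ≡ ∑ (words n xs) g
words-cong zero    xs h = cong (_+ + 0) (h [] refl [])
words-cong (suc n) xs {f} {g} h = begin
  ∑ (words (suc n) xs) f                       ≡⟨ ∑-concatMap _ xs f ⟩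
  ∑ xs (λ x → ∑ (map (x ∷_) (words n xs)) f)   ≡⟨ ∑-cong∈ xs (λ x x∈ → begin
      ∑ (map (x ∷_) (words n xs)) f               ≡⟨ ∑-map (x ∷_) (words n xs) f ⟩
      ∑ (words n xs) (λ w → f (x ∷ w))            ≡⟨ words-cong n xs (λ w |w| w∈ → h (x ∷ w) (cong suc |w|) (x∈ ∷ w∈)) ⟩
      ∑ (words n xs) (λ w → g (x ∷ w))            ≡⟨ sym (∑-map (x ∷_) (words n xs) g) ⟩
      ∑ (map (x ∷_) (words n xs)) g               ∎) ⟩
  ∑ xs (λ x → ∑ (map (x ∷_) (words n xs)) g)   ≡⟨ sym (∑-concatMap _ xs g) ⟩
  ∑ (words (suc n) xs) g                       ∎
  where open ≡-Reasoning

∑-signedVals : ∀ d (g : ℤ → ℤ) → ∑ (signedVals d) g ≡ ∑< d (λ a' → g -[1+ a' ] + g (+ suc a'))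
∑-signedVals d g = begin
  ∑ (signedVals d) g
    ≡⟨ ∑-++ (map (λ k → - (+ k)) (range d)) (map +_ (range d)) g ⟩
  ∑ (map (λ k → - (+ k)) (range d)) g + ∑ (map +_ (range d)) g
    ≡⟨ cong₂ _+_ (trans (∑-map _ (range d) g) (∑-map suc (upTo d) _))
                 (trans (∑-map +_ (range d) g) (∑-map suc (upTo d) _)) ⟩
  ∑ (upTo d) (λ a' → g -[1+ a' ]) + ∑ (upTo d) (λ a' → g (+ suc a'))
    ≡⟨ cong₂ _+_ (∑-upTo d _) (∑-upTo d _) ⟩
  ∑< d (λ a' → g -[1+ a' ]) + ∑< d (λ a' → g (+ suc a'))
    ≡⟨ sym (∑<-+ d _ _) ⟩
  ∑< d (λ a' → g -[1+ a' ] + g (+ suc a'))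
    ∎
  where open ≡-Reasoning

NatSet : Set
NatSet = ℕ → Bool

full : NatSet
full _ = true

true≢false : ¬ true ≡ false
true≢false ()

remove : NatSet → ℕ → NatSet
remove A a b = A b ∧ not (does (b ℕ.≟ a))

remove-self : ∀ A a → remove A a a ≡ false
remove-self A a rewrite dec-true (a ℕ.≟ a) refl = Data.Bool.Properties.∧-zeroʳ (A a)

remove-other : ∀ A a b → ¬ b ≡ a → remove A a b ≡ A b
remove-other A a b b≢a rewrite dec-false (b ℕ.≟ a) b≢a = Data.Bool.Properties.∧-identityʳ (A b)

remove-comm : ∀ A p q b → remove (remove A p) q b ≡ remove (remove A q) p b
remove-comm A p q b with A b | does (b ℕ.≟ p) | does (b ℕ.≟ q)
... | true  | true  | true  = refl
... | true  | true  | false = refl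
... | true  | false | true  = refl
... | true  | false | false = refl
... | false | _     | _     = refl

≟-sym : ∀ m n → does (m ℕ.≟ n) ≡ does (n ℕ.≟ m)
≟-sym m n with m ℕ.≟ n
... | yes m≡n = trans (dec-true (m ℕ.≟ n) m≡n) (sym (dec-true (n ℕ.≟ m) (sym m≡n)))
... | no  m≢n = trans (dec-false (m ℕ.≟ n) m≢n) (sym (dec-false (n ℕ.≟ m) (λ n≡m → m≢n (sym n≡m))))

-- size A k = #(A ∩ {1,…,k}); for a ∈ A, size A (a - 1) is the rank of a in A.
size : NatSet → ℕ → ℕ
size A zero    = 0
size A (suc k) = if A (suc k) then suc (size A k) else size A k

size-full : ∀ k → size full k ≡ k
size-full zero    = refl
size-full (suc k) = cong suc (size-full k)

size-step : ∀ A k → size A k ≤ size A (suc k)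
size-step A k with A (suc k)
... | true  = ℕP.n≤1+n (size A k)
... | false = ℕP.≤-refl

size-mono : ∀ A {x y} → x ≤ y → size A x ≤ size A y
size-mono A x≤y = go (ℕP.≤⇒≤′ x≤y)
  where
  go : ∀ {x y} → x ℕ.≤′ y → size A x ≤ size A y
  go ℕ.≤′-refl       = ℕP.≤-refl
  go (ℕ.≤′-step x≤y) = ℕP.≤-trans (go x≤y) (size-step A _)

size-< : ∀ A {a' u'} → A (suc a') ≡ true → a' < u' → size A a' < size A u'
size-< A {a'} Aa a'<u' = ℕP.<-≤-trans lt (size-mono A a'<u')
  where
  lt : size A a' < size A (suc a')
  lt rewrite Aa = ℕP.≤-refl

-- For a ∈ A and u ∉ A, comparing the letters ±u and ±a is comparing the ranks of u and a in A.
rank-pos : ∀ A {a' u'} → A (suc a') ≡ true → A (suc u') ≡ false →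
  does (+ suc u' ℤP.<? + suc a') ≡ does (size A u' ℕ.≤? size A a')
rank-pos A {a'} {u'} Aa Au with ℕP.<-cmp u' a'
... | tri< u'<a' _ _ = trans (dec-true (+ suc u' ℤP.<? + suc a') (ℤ.+<+ (s≤s u'<a')))
                            (sym (dec-true (size A u' ℕ.≤? size A a') (size-mono A (ℕP.<⇒≤ u'<a'))))
... | tri≈ _ refl _  = ⊥-elim (true≢false (trans (sym Aa) Au))
... | tri> _ _ a'<u' = trans (dec-false (+ suc u' ℤP.<? + suc a') (λ p → ℕP.<-asym a'<u' (ℕP.≤-pred (ℤP.drop‿+<+ p))))
                            (sym (dec-false (size A u' ℕ.≤? size A a') (ℕP.<⇒≱ (size-< A Aa a'<u'))))

rank-neg : ∀ A {a' u'} → A (suc a') ≡ true → A (suc u') ≡ false →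
  does (-[1+ u' ] ℤP.<? -[1+ a' ]) ≡ does (size A a' ℕ.<? size A u')
rank-neg A {a'} {u'} Aa Au with ℕP.<-cmp a' u'
... | tri< a'<u' _ _ = trans (dec-true (-[1+ u' ] ℤP.<? -[1+ a' ]) (ℤ.-<- a'<u'))
                            (sym (dec-true (size A a' ℕ.<? size A u') (size-< A Aa a'<u')))
... | tri≈ _ refl _  = ⊥-elim (true≢false (trans (sym Aa) Au))
... | tri> _ _ u'<a' = trans (dec-false (-[1+ u' ] ℤP.<? -[1+ a' ]) (λ p → ℕP.<-asym u'<a' (ℤP.drop‿-<- p)))
                            (sym (dec-false (size A a' ℕ.<? size A u') (ℕP.≤⇒≯ (size-mono A (ℕP.<⇒≤ u'<a')))))

∑-by-rank : ∀ (A : NatSet) (H : ℕ → ℤ) d →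
  ∑< d (λ a' → if A (suc a') then H (size A a') else + 0) ≡ ∑< (size A d) H
∑-by-rank A H zero    = refl
∑-by-rank A H (suc d) with A (suc d)
... | true  = cong (_+ H (size A d)) (∑-by-rank A H d)
... | false = trans (ℤP.+-identityʳ _) (∑-by-rank A H d)

size-remove-below : ∀ A a k → k < a → size (remove A a) k ≡ size A k
size-remove-below A a zero    _   = refl
size-remove-below A a (suc k) k<a
  rewrite remove-other A a (suc k) (λ k≡a → ℕP.<-irrefl k≡a k<a)
        | size-remove-below A a k (ℕP.<-trans (ℕP.n<1+n k) k<a) = refl

size-remove : ∀ A a k → 1 ≤ a → a ≤ k → A a ≡ true → suc (size (remove A a) k) ≡ size A k
size-remove A (suc a') zero    _   ()
size-remove A a (suc k) 1≤a a≤k Aa with a ℕ.≟ suc k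
... | yes refl rewrite remove-self A a | Aa = cong suc (size-remove-below A a k ℕP.≤-refl)
... | no  a≢k rewrite remove-other A a (suc k) (λ k≡a → a≢k (sym k≡a))
                    | sym (size-remove A a k 1≤a (ℕP.≤-pred (ℕP.≤∧≢⇒< a≤k a≢k)) Aa) with A (suc k)
...   | true  = refl
...   | false = refl

prod : NatSet → ℕ → ℕ
prod A zero    = 1
prod A (suc k) = if A (suc k) then prod A k ℕ.* suc k else prod A k

prod-full : ∀ k → prod full k ≡ k !
prod-full zero    = refl
prod-full (suc k) = trans (cong (ℕ._* suc k) (prod-full k)) (ℕP.*-comm (k !) (suc k))

prod-remove-below : ∀ A a k → k < a → prod (remove A a) k ≡ prod A k
prod-remove-below A a zero    _   = refl
prod-remove-below A a (suc k) k<a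
  rewrite remove-other A a (suc k) (λ k≡a → ℕP.<-irrefl k≡a k<a)
        | prod-remove-below A a k (ℕP.<-trans (ℕP.n<1+n k) k<a) = refl

prod-remove : ∀ A a k → 1 ≤ a → a ≤ k → A a ≡ true → a ℕ.* prod (remove A a) k ≡ prod A k
prod-remove A (suc a') zero    _   ()
prod-remove A a (suc k) 1≤a a≤k Aa with a ℕ.≟ suc k
... | yes refl rewrite remove-self A a | Aa | prod-remove-below A a k ℕP.≤-refl = ℕP.*-comm a (prod A k)
... | no  a≢k rewrite remove-other A a (suc k) (λ k≡a → a≢k (sym k≡a)) with A (suc k)
...   | true  = trans (sym (ℕP.*-assoc a (prod (remove A a) k) (suc k)))
                      (cong (ℕ._* suc k) (prod-remove A a k 1≤a (ℕP.≤-pred (ℕP.≤∧≢⇒< a≤k a≢k)) Aa))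
...   | false = prod-remove A a k 1≤a (ℕP.≤-pred (ℕP.≤∧≢⇒< a≤k a≢k)) Aa

prod-empty : ∀ A k → size A k ≡ 0 → prod A k ≡ 1
prod-empty A zero    _ = refl
prod-empty A (suc k) e with A (suc k)
... | true  = ⊥-elim (ℕP.1+n≢0 e)
... | false = prod-empty A k e

fresh : NatSet → List ℤ → Bool
fresh A []      = true
fresh A (x ∷ w) = A ∣ x ∣ ∧ fresh (remove A ∣ x ∣) w

fresh-ext : ∀ {A B} w → (∀ b → A b ≡ B b) → fresh A w ≡ fresh B w
fresh-ext []      A≗B = refl
fresh-ext (x ∷ w) A≗B =
  cong₂ _∧_ (A≗B ∣ x ∣) (fresh-ext w (λ b → cong (λ c → c ∧ not (does (b ℕ.≟ ∣ x ∣))) (A≗B b)))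

fresh-snoc : ∀ A r y → fresh A (r ++ y ∷ []) ≡ A ∣ y ∣ ∧ fresh (remove A ∣ y ∣) r
fresh-snoc A []      y = refl
fresh-snoc A (x ∷ r) y = begin
  A ∣ x ∣ ∧ fresh (remove A ∣ x ∣) (r ++ y ∷ [])
    ≡⟨ cong (A ∣ x ∣ ∧_) (fresh-snoc (remove A ∣ x ∣) r y) ⟩
  A ∣ x ∣ ∧ ((A ∣ y ∣ ∧ not (does (∣ y ∣ ℕ.≟ ∣ x ∣))) ∧ fresh (remove (remove A ∣ x ∣) ∣ y ∣) r)
    ≡⟨ cong₂ (λ c f → A ∣ x ∣ ∧ ((A ∣ y ∣ ∧ not c) ∧ f)) (≟-sym ∣ y ∣ ∣ x ∣) (fresh-ext r (remove-comm A ∣ x ∣ ∣ y ∣)) ⟩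
  A ∣ x ∣ ∧ ((A ∣ y ∣ ∧ not (does (∣ x ∣ ℕ.≟ ∣ y ∣))) ∧ fresh (remove (remove A ∣ y ∣) ∣ x ∣) r)
    ≡⟨ exchange (A ∣ x ∣) (A ∣ y ∣) _ _ ⟩
  A ∣ y ∣ ∧ ((A ∣ x ∣ ∧ not (does (∣ x ∣ ℕ.≟ ∣ y ∣))) ∧ fresh (remove (remove A ∣ y ∣) ∣ x ∣) r)
    ∎
  where
  open ≡-Reasoning
  exchange : ∀ a b c f → a ∧ ((b ∧ c) ∧ f) ≡ b ∧ ((a ∧ c) ∧ f)
  exchange true  true  c f = refl
  exchange true  false c f = refl
  exchange false true  c f = refl
  exchange false false c f = refl

∧-true : ∀ {a b} → a ∧ b ≡ true → (a ≡ true) × (b ≡ true)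
∧-true {true} {true} _ = refl , refl

fresh⇒All : ∀ A w → fresh A w ≡ true → All (λ y → A ∣ y ∣ ≡ true) w
fresh⇒All A []      _ = []
fresh⇒All A (x ∷ w) e with ∧-true {A ∣ x ∣} e
... | Ax , ew = Ax ∷ Data.List.Relation.Unary.All.map (λ {y} p → proj₁ (∧-true {A ∣ y ∣} p)) (fresh⇒All (remove A ∣ x ∣) w ew)

fresh⇒Unique : ∀ A w → fresh A w ≡ true → Unique (map ∣_∣ w)
fresh⇒Unique A []      _ = []
fresh⇒Unique A (x ∷ w) e with ∧-true {A ∣ x ∣} e
... | _ , ew = AllP.map⁺ (Data.List.Relation.Unary.All.map (λ {y} → distinct y) (fresh⇒All (remove A ∣ x ∣) w ew))
             ∷ fresh⇒Unique (remove A ∣ x ∣) w ew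
  where
  distinct : ∀ y → remove A ∣ x ∣ ∣ y ∣ ≡ true → ¬ ∣ x ∣ ≡ ∣ y ∣
  distinct y p x≡y with trans (sym p) (trans (cong (remove A ∣ x ∣) (sym x≡y)) (remove-self A ∣ x ∣))
  ... | ()

Unique⇒fresh : ∀ A w → Unique (map ∣_∣ w) → All (λ y → A ∣ y ∣ ≡ true) w → fresh A w ≡ true
Unique⇒fresh A []      _          _         = refl
Unique⇒fresh A (x ∷ w) (x∉ ∷ uw) (Ax ∷ Aw) rewrite Ax =
  Unique⇒fresh (remove A ∣ x ∣) w uw (still-in w (AllP.map⁻ x∉) Aw)
  where
  still-in : ∀ w → All (λ y → ¬ ∣ x ∣ ≡ ∣ y ∣) w → All (λ y → A ∣ y ∣ ≡ true) w →
    All (λ y → remove A ∣ x ∣ ∣ y ∣ ≡ true) w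
  still-in []      _          _         = []
  still-in (y ∷ w) (x≢y ∷ ns) (Ay ∷ Aw) = trans (remove-other A ∣ x ∣ ∣ y ∣ (λ y≡x → x≢y (sym y≡x))) Ay ∷ still-in w ns Aw

fresh-full : ∀ w → does (UD.unique? ℕ._≟_ (map ∣_∣ w)) ≡ fresh full w
fresh-full w with fresh full w in eq
... | true  = dec-true (UD.unique? ℕ._≟_ (map ∣_∣ w)) (fresh⇒Unique full w eq)
... | false = dec-false (UD.unique? ℕ._≟_ (map ∣_∣ w))
                (λ u → true≢false (trans (sym (Unique⇒fresh full w u (Data.List.Relation.Unary.All.tabulate (λ _ → refl)))) eq))

removeAll : NatSet → List ℤ → NatSet
removeAll A []      = A
removeAll A (x ∷ w) = removeAll (remove A ∣ x ∣) w

absProduct : List ℤ → ℕ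
absProduct []      = 1
absProduct (x ∷ w) = ∣ x ∣ ℕ.* absProduct w

InRange : ℕ → ℤ → Set
InRange d x = 1 ≤ ∣ x ∣ × ∣ x ∣ ≤ d

fresh-size : ∀ d A w → fresh A w ≡ true → All (InRange d) w →
  length w ℕ.+ size (removeAll A w) d ≡ size A d
fresh-size d A []      _ _ = refl
fresh-size d A (x ∷ w) e ((1≤x , x≤d) ∷ ws) with ∧-true {A ∣ x ∣} e
... | Ax , ew = trans (cong suc (fresh-size d (remove A ∣ x ∣) w ew ws)) (size-remove A ∣ x ∣ d 1≤x x≤d Ax)

fresh-prod : ∀ d A w → fresh A w ≡ true → All (InRange d) w →
  absProduct w ℕ.* prod (removeAll A w) d ≡ prod A d
fresh-prod d A []      _ _ = ℕP.+-identityʳ _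
fresh-prod d A (x ∷ w) e ((1≤x , x≤d) ∷ ws) with ∧-true {A ∣ x ∣} e
... | Ax , ew = begin
  ∣ x ∣ ℕ.* absProduct w ℕ.* prod (removeAll (remove A ∣ x ∣) w) d
    ≡⟨ ℕP.*-assoc ∣ x ∣ (absProduct w) _ ⟩
  ∣ x ∣ ℕ.* (absProduct w ℕ.* prod (removeAll (remove A ∣ x ∣) w) d)
    ≡⟨ cong (∣ x ∣ ℕ.*_) (fresh-prod d (remove A ∣ x ∣) w ew ws) ⟩
  ∣ x ∣ ℕ.* prod (remove A ∣ x ∣) d
    ≡⟨ prod-remove A ∣ x ∣ d 1≤x x≤d Ax ⟩
  prod A d
    ∎
  where open ≡-Reasoning

absProduct-perm : ∀ d w → fresh full w ≡ true → length w ≡ d → All (InRange d) w → absProduct w ≡ d !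
absProduct-perm d w ok |w| ws = begin
  absProduct w                                     ≡⟨ sym (ℕP.*-identityʳ _) ⟩
  absProduct w ℕ.* 1                               ≡⟨ cong (absProduct w ℕ.*_) (sym (prod-empty (removeAll full w) d used-up)) ⟩
  absProduct w ℕ.* prod (removeAll full w) d       ≡⟨ fresh-prod d full w ok ws ⟩
  prod full d                                      ≡⟨ prod-full d ⟩
  d !                                              ∎
  where
  open ≡-Reasoning
  used-up : size (removeAll full w) d ≡ 0
  used-up = ℕP.+-cancelˡ-≡ d _ _ (begin
    d ℕ.+ size (removeAll full w) d              ≡⟨ cong (ℕ._+ size (removeAll full w) d) (sym |w|) ⟩
    length w ℕ.+ size (removeAll full w) d       ≡⟨ fresh-size d full w ok ws ⟩
    size full d                                  ≡⟨ size-full d ⟩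
    d                                            ≡⟨ sym (ℕP.+-identityʳ d) ⟩
    d ℕ.+ 0                                      ∎)

signedVals-InRange : ∀ d x → x ∈ signedVals d → InRange d x
signedVals-InRange d x x∈ with ∈-++⁻ (map (λ k → - (+ k)) (range d)) x∈
... | inj₁ x∈⁻ with ∈-map⁻ (λ k → - (+ k)) x∈⁻
...   | k , k∈ , refl with ∈-map⁻ suc k∈
...     | i , i∈ , refl = s≤s z≤n , ∈-upTo⁻ i∈
signedVals-InRange d x x∈ | inj₂ x∈⁺ with ∈-map⁻ +_ x∈⁺
...   | k , k∈ , refl with ∈-map⁻ suc k∈
...     | i , i∈ , refl = s≤s z≤n , ∈-upTo⁻ i∈

lastSat : (ℤ → Bool) → List ℤ → Bool
lastSat φ []          = false
lastSat φ (x ∷ [])    = φ x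
lastSat φ (x ∷ y ∷ w) = lastSat φ (y ∷ w)

lastSat-snoc : ∀ φ r y → lastSat φ (r ++ y ∷ []) ≡ φ y
lastSat-snoc φ []          y = refl
lastSat-snoc φ (x ∷ [])    y = refl
lastSat-snoc φ (x ∷ x' ∷ r) y = lastSat-snoc φ (x' ∷ r) y

-- The test that never holds: no extra factor for the last letter.
never : ℤ → Bool
never _ = false

lastSat-never : ∀ w → lastSat never w ≡ false
lastSat-never []          = refl
lastSat-never (x ∷ [])    = refl
lastSat-never (x ∷ x' ∷ w) = lastSat-never (x' ∷ w)

-- above y x holds when x > y, i.e. when x followed by y is a descent.
above : ℤ → ℤ → Bool
above y x = does (y ℤP.<? x)

desSum-snoc : ∀ i r y →
  desSum i (r ++ y ∷ []) ≡ desSum i r ℕ.+ (if lastSat (above y) r then ℕ.pred (length r) ℕ.+ i else 0)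
desSum-snoc i []           y = refl
desSum-snoc i (x ∷ [])     y = ℕP.+-identityʳ _
desSum-snoc i (x ∷ x' ∷ r) y rewrite desSum-snoc (suc i) (x' ∷ r) y with lastSat (above y) (x' ∷ r)
... | false = sym (ℕP.+-assoc (if does (x' ℤP.<? x) then i else 0) _ _)
... | true  = trans (cong (λ k → (if does (x' ℤP.<? x) then i else 0) ℕ.+ (desSum (suc i) (x' ∷ r) ℕ.+ k))
                          (ℕP.+-suc (length r) i))
                    (sym (ℕP.+-assoc (if does (x' ℤP.<? x) then i else 0) _ _))

maj : List ℤ → ℕ
maj = desSum 1

maj-snoc : ∀ r y → maj (r ++ y ∷ []) ≡ maj r ℕ.+ (if lastSat (above y) r then length r else 0)
maj-snoc r y = trans (desSum-snoc 1 r y) (cong (maj r ℕ.+_) (last-position r))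
  where
  last-position : ∀ r → (if lastSat (above y) r then ℕ.pred (length r) ℕ.+ 1 else 0)
                        ≡ (if lastSat (above y) r then length r else 0)
  last-position []      = refl
  last-position (x ∷ r) with lastSat (above y) (x ∷ r)
  ... | true  = ℕP.+-comm (length r) 1
  ... | false = refl

negCount-snoc : ∀ r y → negCount (r ++ y ∷ []) ≡ negCount r ℕ.+ negCount (y ∷ [])
negCount-snoc r y = trans (cong length (LP.filter-++ (λ x → x ℤP.<? + 0) r (y ∷ []))) (LP.length-++ (filter _ r))

length-snoc : ∀ (r : List ℤ) y → length (r ++ y ∷ []) ≡ suc (length r)
length-snoc r y = trans (LP.length-++ r) (ℕP.+-comm (length r) 1)

isEven : ℕ → Bool
isEven zero    = true
isEven (suc k) = not (isEven k)

-- e ± i is i with the sign (-1)^k when e = isEven k.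
infix 5 _±_
_±_ : Bool → ℤ → ℤ
e ± i = if e then i else - i

±-*ˡ : ∀ e (i j : ℤ) → i * (e ± j) ≡ e ± (i * j)
±-*ˡ true  i j = refl
±-*ˡ false i j = sym (ℤP.neg-distribʳ-* i j)

±-neg-*ˡ : ∀ e (i j : ℤ) → - i * (e ± j) ≡ not e ± (i * j)
±-neg-*ˡ true  i j = sym (ℤP.neg-distribˡ-* i j)
±-neg-*ˡ false i j = neg-neg i j
  where
  neg-neg : ∀ (i j : ℤ) → - i * - j ≡ i * j
  neg-neg = solve-∀

product-sign : ∀ w → foldr _*_ (+ 1) w ≡ isEven (negCount w) ± + absProduct w
product-sign []             = refl
product-sign (+ n ∷ w)      = begin
  + n * foldr _*_ (+ 1) w                      ≡⟨ cong (+ n *_) (product-sign w) ⟩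
  + n * (isEven (negCount w) ± + absProduct w) ≡⟨ ±-*ˡ (isEven (negCount w)) (+ n) _ ⟩
  isEven (negCount w) ± (+ n * + absProduct w) ≡⟨ cong (isEven (negCount w) ±_) (sym (ℤP.pos-* n (absProduct w))) ⟩
  isEven (negCount w) ± + (n ℕ.* absProduct w) ∎
  where open ≡-Reasoning
product-sign (-[1+ n ] ∷ w) = begin
  -[1+ n ] * foldr _*_ (+ 1) w                        ≡⟨ cong (-[1+ n ] *_) (product-sign w) ⟩
  - (+ suc n) * (isEven (negCount w) ± + absProduct w)  ≡⟨ ±-neg-*ˡ (isEven (negCount w)) (+ suc n) _ ⟩
  not (isEven (negCount w)) ± (+ suc n * + absProduct w)
    ≡⟨ cong (not (isEven (negCount w)) ±_) (sym (ℤP.pos-* (suc n) (absProduct w))) ⟩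
  not (isEven (negCount w)) ± + (suc n ℕ.* absProduct w) ∎
  where open ≡-Reasoning

neg-^ : ∀ (t : ℤ) k → (- t) ^ k ≡ isEven k ± (t ^ k)
neg-^ t zero    = refl
neg-^ t (suc k) = trans (cong (- t *_) (neg-^ t k)) (±-neg-*ˡ (isEven k) t (t ^ k))

inTypeD-sign : ∀ d w → fresh full w ≡ true → length w ≡ d → All (InRange d) w →
  does (foldr _*_ (+ 1) w ℤP.≟ + (d !)) ≡ isEven (negCount w)
inTypeD-sign d w ok |w| ws rewrite product-sign w | absProduct-perm d w ok |w| ws with d ! | ℕP.1≤n! d
... | suc m | _ = sign-test (isEven (negCount w))
  where
  sign-test : ∀ e → does ((e ± + suc m) ℤP.≟ + suc m) ≡ e
  sign-test true  = dec-true (+ suc m ℤP.≟ + suc m) refl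
  sign-test false = dec-false (-[1+ m ] ℤP.≟ + suc m) (λ ())

∸-suc : ∀ {N j} → j < N → N ∸ j ≡ suc (N ∸ suc j)
∸-suc {suc N} {zero}  _         = refl
∸-suc {suc N} {suc j} (s≤s j<N) = ∸-suc j<N

≤?-off : ∀ {α j} → ¬ j ≡ α → does (α ℕ.≤? j) ≡ does (α ℕ.<? j)
≤?-off {α} {j} j≢α with ℕP.<-cmp α j
... | tri< α<j _ _ = trans (dec-true (α ℕ.≤? j) (ℕP.<⇒≤ α<j)) (sym (dec-true (α ℕ.<? j) α<j))
... | tri≈ _ α≡j _ = ⊥-elim (j≢α (sym α≡j))
... | tri> _ _ j<α = trans (dec-false (α ℕ.≤? j) (ℕP.<⇒≱ j<α)) (sym (dec-false (α ℕ.<? j) (ℕP.<⇒≯ j<α)))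

<?-off : ∀ {j β} → ¬ j ≡ β → does (j ℕ.<? suc β) ≡ does (j ℕ.<? β)
<?-off {j} {β} j≢β with ℕP.<-cmp j β
... | tri< j<β _ _ = trans (dec-true (j ℕ.<? suc β) (ℕP.m<n⇒m<1+n j<β)) (sym (dec-true (j ℕ.<? β) j<β))
... | tri≈ _ j≡β _ = ⊥-elim (j≢β j≡β)
... | tri> _ _ β<j = trans (dec-false (j ℕ.<? suc β) (λ j<1+β → ℕP.<-irrefl refl (ℕP.<-≤-trans β<j (ℕP.≤-pred j<1+β))))
                           (sym (dec-false (j ℕ.<? β) (ℕP.<⇒≯ β<j)))

-- Three polynomial identities in t and z, each a sum Σ_{j<N} of terms weighted by
-- c_N(j) = (1+z)^j (t+z)^{N-1-j}. They evaluate the last-letter recursion below.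
module Identities (t z : ℤ) where

  Q : ℕ → ℤ
  Q N = qInt N t

  Q-∑< : ∀ N → Q N ≡ ∑< N (t ^_)
  Q-∑< N = trans (foldr-map≡∑ (upTo N) (t ^_)) (∑-upTo N (t ^_))

  Q-snoc : ∀ N → Q (suc N) ≡ Q N + t ^ N
  Q-snoc N = trans (Q-∑< (suc N)) (cong (_+ t ^ N) (sym (Q-∑< N)))

  Q-cons : ∀ N → Q (suc N) ≡ + 1 + t * Q N
  Q-cons N = begin
    Q (suc N)                      ≡⟨ Q-∑< (suc N) ⟩
    ∑< (suc N) (t ^_)              ≡⟨ ∑<-shift N (t ^_) ⟩
    + 1 + ∑< N (λ j → t * t ^ j)   ≡⟨ cong (_+_ (+ 1)) (∑<-*ˡ N t (t ^_)) ⟩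
    + 1 + t * ∑< N (t ^_)          ≡⟨ cong (λ q → + 1 + t * q) (sym (Q-∑< N)) ⟩
    + 1 + t * Q N                  ∎
    where open ≡-Reasoning

  Q-geometric : ∀ N → Q N * (t - + 1) ≡ t ^ N - + 1
  Q-geometric zero    = refl
  Q-geometric (suc N) = begin
    Q (suc N) * (t - + 1)                   ≡⟨ cong (_* (t - + 1)) (Q-snoc N) ⟩
    (Q N + t ^ N) * (t - + 1)               ≡⟨ distrib t (Q N) (t ^ N) ⟩
    Q N * (t - + 1) + (t * t ^ N - t ^ N)   ≡⟨ cong (_+ (t * t ^ N - t ^ N)) (Q-geometric N) ⟩
    t ^ N - + 1 + (t * t ^ N - t ^ N)       ≡⟨ telescope t (t ^ N) ⟩
    t * t ^ N - + 1                         ∎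
    where
    open ≡-Reasoning
    distrib : ∀ t q p → (q + p) * (t - + 1) ≡ q * (t - + 1) + (t * p - p)
    distrib = solve-∀
    telescope : ∀ t p → p - + 1 + (t * p - p) ≡ t * p - + 1
    telescope = solve-∀

  coeff : ℕ → ℕ → ℤ
  coeff N j = (+ 1 + z) ^ j * (t + z) ^ (N ∸ suc j)

  coeff-suc : ∀ {N j} c → j < N → coeff (suc N) j * c ≡ (t + z) * (coeff N j * c)
  coeff-suc {N} {j} c j<N = trans (cong (λ k → (+ 1 + z) ^ j * (t + z) ^ k * c) (∸-suc j<N))
                                  (pull-out t z ((+ 1 + z) ^ j) ((t + z) ^ (N ∸ suc j)) c)
    where
    pull-out : ∀ t z X Y c → X * ((t + z) * Y) * c ≡ (t + z) * (X * Y * c)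
    pull-out = solve-∀

  coeff-last : ∀ N c → coeff (suc N) N * c ≡ (+ 1 + z) ^ N * c
  coeff-last N c = trans (cong (λ k → (+ 1 + z) ^ N * (t + z) ^ k * c) (ℕP.n∸n≡0 N))
                         (cong (_* c) (ℤP.*-identityʳ ((+ 1 + z) ^ N)))

  sum-free : ∀ N → ∑< N (λ j → coeff N j * (z * t ^ j + + 1)) ≡ Q N * (+ 1 + z) ^ N
  sum-free zero    = refl
  sum-free (suc N) = begin
    ∑< N (λ j → coeff (suc N) j * F j) + coeff (suc N) N * F N
      ≡⟨ cong₂ _+_ (∑<-cong N (λ j j<N → coeff-suc (F j) j<N)) (coeff-last N (F N)) ⟩
    ∑< N (λ j → (t + z) * (coeff N j * F j)) + X * F N
      ≡⟨ cong (_+ X * F N) (trans (∑<-*ˡ N (t + z) _) (cong ((t + z) *_) (sum-free N))) ⟩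
    (t + z) * (Q N * X) + X * F N
      ≡⟨ regroup t z (Q N) (t ^ N) X ⟩
    X * (+ 1 + t * Q N) + X * z * (Q N + t ^ N)
      ≡⟨ cong₂ (λ a b → X * a + X * z * b) (sym (Q-cons N)) (sym (Q-snoc N)) ⟩
    X * Q (suc N) + X * z * Q (suc N)
      ≡⟨ factor z (Q (suc N)) X ⟩
    Q (suc N) * ((+ 1 + z) * X)
      ∎
    where
    open ≡-Reasoning
    F : ℕ → ℤ
    F j = z * t ^ j + + 1
    X : ℤ
    X = (+ 1 + z) ^ N
    regroup : ∀ t z q p X → (t + z) * (q * X) + X * (z * p + + 1) ≡ X * (+ 1 + t * q) + X * z * (q + p)
    regroup = solve-∀
    factor : ∀ z q X → X * q + X * z * q ≡ q * ((+ 1 + z) * X)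
    factor = solve-∀

  -- Terms for a word followed by a positive letter whose rank among the available values is α.
  posTerm : ℕ → ℕ → ℕ → ℤ
  posTerm N α j = coeff N j * (z * t ^ j + (if does (α ℕ.≤? j) then t ^ N else + 1))

  -- Σ_{j<N} posTerm N α j = [N]_t (1+z)^α (t+z)^{N-α}, by downward induction on α ≤ N.
  sum-pos : ∀ N α → α ≤ N → ∑< N (posTerm N α) ≡ Q N * (+ 1 + z) ^ α * (t + z) ^ (N ∸ α)
  sum-pos N α α≤N = down (N ∸ α) α (ℕP.m+[n∸m]≡n α≤N)
    where
    open ≡-Reasoning
    down : ∀ k α → α ℕ.+ k ≡ N → ∑< N (posTerm N α) ≡ Q N * (+ 1 + z) ^ α * (t + z) ^ (N ∸ α)
    down zero α α+0≡N rewrite ℕP.+-identityʳ α | α+0≡N = begin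
      ∑< N (posTerm N N)
        ≡⟨ ∑<-cong N (λ j j<N → cong (λ b → coeff N j * (z * t ^ j + (if b then t ^ N else + 1)))
                                     (dec-false (N ℕ.≤? j) (ℕP.<⇒≱ j<N))) ⟩
      ∑< N (λ j → coeff N j * (z * t ^ j + + 1))
        ≡⟨ sum-free N ⟩
      Q N * (+ 1 + z) ^ N
        ≡⟨ sym (trans (cong (λ k → Q N * (+ 1 + z) ^ N * (t + z) ^ k) (ℕP.n∸n≡0 N)) (ℤP.*-identityʳ _)) ⟩
      Q N * (+ 1 + z) ^ N * (t + z) ^ (N ∸ N)
        ∎
    down (suc k) α α+k≡N = begin
      ∑< N (posTerm N α)
        ≡⟨ ∑<-point N α (posTerm N α) (posTerm N (suc α)) δ α<N
             (λ j _ j≢α → cong (λ b → coeff N j * (z * t ^ j + (if b then t ^ N else + 1))) (≤?-off j≢α)) at-α ⟩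
      ∑< N (posTerm N (suc α)) + δ
        ≡⟨ cong (_+ δ) (down k (suc α) (trans (sym (ℕP.+-suc α k)) α+k≡N)) ⟩
      Q N * X′ * Y + X * Y * (t ^ N - + 1)
        ≡⟨ cong (λ e → Q N * X′ * Y + X * Y * e) (sym (Q-geometric N)) ⟩
      Q N * ((+ 1 + z) * X) * Y + X * Y * (Q N * (t - + 1))
        ≡⟨ collect t z (Q N) X Y ⟩
      Q N * X * ((t + z) * Y)
        ≡⟨ cong (λ k → Q N * X * (t + z) ^ k) (sym (∸-suc α<N)) ⟩
      Q N * X * (t + z) ^ (N ∸ α)
        ∎
      where
      X X′ Y δ : ℤ
      X = (+ 1 + z) ^ α
      X′ = (+ 1 + z) ^ suc α
      Y = (t + z) ^ (N ∸ suc α)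
      δ = X * Y * (t ^ N - + 1)
      α<N : α < N
      α<N = subst (α <_) α+k≡N (ℕP.m<m+n α (s≤s z≤n))
      at-α : posTerm N α α ≡ posTerm N (suc α) α + δ
      at-α rewrite dec-true (α ℕ.≤? α) ℕP.≤-refl | dec-false (suc α ℕ.≤? α) (ℕP.n≮n α) =
        split-top z X Y (t ^ α) (t ^ N)
        where
        split-top : ∀ z X Y p tN → X * Y * (z * p + tN) ≡ X * Y * (z * p + + 1) + X * Y * (tN - + 1)
        split-top = solve-∀
      collect : ∀ t z q X Y → q * ((+ 1 + z) * X) * Y + X * Y * (q * (t - + 1)) ≡ q * X * ((t + z) * Y)
      collect = solve-∀

  -- Terms for a word followed by a negative letter whose rank among the available values is β.
  negTerm : ℕ → ℕ → ℕ → ℤ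
  negTerm N β j = coeff N j * (z * (if does (j ℕ.<? β) then t ^ N else + 1) * t ^ j + t ^ N)

  -- Σ_{j<N} negTerm N β j = [N]_t t^β (1+z)^β (t+z)^{N-β}, by upward induction on β from sum-pos N 0.
  sum-neg : ∀ N β → β ≤ N → ∑< N (negTerm N β) ≡ Q N * t ^ β * (+ 1 + z) ^ β * (t + z) ^ (N ∸ β)
  sum-neg N zero _ = begin
    ∑< N (negTerm N 0)
      ≡⟨ ∑<-cong N (λ j _ → cong (λ c → coeff N j * (c * t ^ j + t ^ N)) (ℤP.*-identityʳ z)) ⟩
    ∑< N (posTerm N 0)
      ≡⟨ sum-pos N 0 z≤n ⟩
    Q N * + 1 * (t + z) ^ N
      ≡⟨ cong (_* (t + z) ^ N) (sym (ℤP.*-identityʳ (Q N * + 1))) ⟩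
    Q N * + 1 * + 1 * (t + z) ^ N
      ∎
    where open ≡-Reasoning
  sum-neg N (suc β) β<N = begin
    ∑< N (negTerm N (suc β))
      ≡⟨ ∑<-point N β (negTerm N (suc β)) (negTerm N β) δ β<N
           (λ j _ j≢β → cong (λ b → coeff N j * (z * (if b then t ^ N else + 1) * t ^ j + t ^ N)) (<?-off j≢β)) at-β ⟩
    ∑< N (negTerm N β) + δ
      ≡⟨ cong (_+ δ) (sum-neg N β (ℕP.<⇒≤ β<N)) ⟩
    Q N * P * X * (t + z) ^ (N ∸ β) + δ
      ≡⟨ cong₂ (λ k e → Q N * P * X * (t + z) ^ k + X * Y * (z * P * e)) (∸-suc β<N) (sym (Q-geometric N)) ⟩
    Q N * P * X * (t + z) ^ suc (N ∸ suc β) + X * Y * (z * P * (Q N * (t - + 1)))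
      ≡⟨ collect t z (Q N) X Y P ⟩
    Q N * (t * P) * ((+ 1 + z) * X) * Y
      ∎
    where
    open ≡-Reasoning
    P X Y δ : ℤ
    P = t ^ β
    X = (+ 1 + z) ^ β
    Y = (t + z) ^ (N ∸ suc β)
    δ = X * Y * (z * P * (t ^ N - + 1))
    at-β : negTerm N (suc β) β ≡ negTerm N β β + δ
    at-β rewrite dec-true (β ℕ.<? suc β) (ℕP.n<1+n β) | dec-false (β ℕ.<? β) (ℕP.n≮n β) =
      split-top z X Y P (t ^ N)
      where
      split-top : ∀ z X Y P tN → X * Y * (z * tN * P + tN) ≡ X * Y * (z * + 1 * P + tN) + X * Y * (z * P * (tN - + 1))
      split-top = solve-∀
    collect : ∀ t z q X Y P → q * P * X * ((t + z) * Y) + X * Y * (z * P * (q * (t - + 1))) ≡ q * (t * P) * ((+ 1 + z) * X) * Y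
    collect = solve-∀

foldr-*-init : ∀ (xs : List ℤ) c → foldr _*_ c xs ≡ foldr _*_ (+ 1) xs * c
foldr-*-init []       c = sym (ℤP.*-identityˡ c)
foldr-*-init (x ∷ xs) c = trans (cong (x *_) (foldr-*-init xs c)) (sym (ℤP.*-assoc x _ c))

qFact-suc : ∀ n t → qFact (suc n) t ≡ qFact n t * qInt (suc n) t
qFact-suc n t = begin
  foldr _*_ (+ 1) (map [_] (range (suc n)))
    ≡⟨ cong (λ xs → foldr _*_ (+ 1) (map [_] xs)) range-suc ⟩
  foldr _*_ (+ 1) (map [_] (range n ++ suc n ∷ []))
    ≡⟨ cong (foldr _*_ (+ 1)) (LP.map-++ [_] (range n) (suc n ∷ [])) ⟩
  foldr _*_ (+ 1) (map [_] (range n) ++ [ suc n ] ∷ [])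
    ≡⟨ LP.foldr-++ _*_ (+ 1) (map [_] (range n)) ([ suc n ] ∷ []) ⟩
  foldr _*_ ([ suc n ] * + 1) (map [_] (range n))
    ≡⟨ foldr-*-init (map [_] (range n)) _ ⟩
  qFact n t * ([ suc n ] * + 1)
    ≡⟨ cong (qFact n t *_) (ℤP.*-identityʳ [ suc n ]) ⟩
  qFact n t * [ suc n ]
    ∎
  where
  open ≡-Reasoning
  [_] : ℕ → ℤ
  [ j ] = qInt j t
  range-suc : range (suc n) ≡ range n ++ suc n ∷ []
  range-suc = trans (cong (map suc) (sym (LP.upTo-∷ʳ n))) (LP.map-++ suc (upTo n) (n ∷ []))

-- For a set A of available absolute values and a test φ on the letter that will follow,
-- S A φ n sums t^maj(w) z^neg(w) over the fresh words w of length n, with an extra factor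
-- t^n when the last letter of w satisfies φ (i.e. when a descent is created at position n).
module Refined (d : ℕ) (t z : ℤ) where
  open Identities t z

  V : List ℤ
  V = signedVals d

  weight : NatSet → (ℤ → Bool) → List ℤ → ℤ
  weight A φ w = if fresh A w
    then t ^ maj w * z ^ negCount w * (if lastSat φ w then t ^ length w else + 1)
    else + 0

  S : NatSet → (ℤ → Bool) → ℕ → ℤ
  S A φ n = ∑ (words n V) (weight A φ)

  lastFactor : (ℤ → Bool) → ℕ → ℤ → ℤ
  lastFactor φ n y = z ^ negCount (y ∷ []) * (if φ y then t ^ suc n else + 1)

  reorder : ∀ T E N M F → T * E * (N * M) * F ≡ M * F * (T * N * E)
  reorder = solve-∀

  weight-snoc : ∀ A φ n r y → length r ≡ n →
    weight A φ (r ++ y ∷ []) ≡ (if A ∣ y ∣ then lastFactor φ n y * weight (remove A ∣ y ∣) (above y) r else + 0)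
  weight-snoc A φ n r y |r| rewrite fresh-snoc A r y with A ∣ y ∣
  ... | false = refl
  ... | true with fresh (remove A ∣ y ∣) r
  ...   | false = sym (ℤP.*-zeroʳ (lastFactor φ n y))
  ...   | true rewrite lastSat-snoc φ r y | length-snoc r y | maj-snoc r y | negCount-snoc r y
                     | ℤP.^-distribˡ-+-* t (maj r) (if lastSat (above y) r then length r else 0)
                     | ℤP.^-distribˡ-+-* z (negCount r) (negCount (y ∷ [])) | |r|
                     with lastSat (above y) r
  ...     | true  = reorder (t ^ maj r) (t ^ n) (z ^ negCount r) (z ^ negCount (y ∷ [])) (if φ y then t ^ suc n else + 1)
  ...     | false = reorder (t ^ maj r) (+ 1) (z ^ negCount r) (z ^ negCount (y ∷ [])) (if φ y then t ^ suc n else + 1)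

  S-snoc : ∀ A φ n →
    S A φ (suc n) ≡ ∑ V (λ y → if A ∣ y ∣ then lastFactor φ n y * S (remove A ∣ y ∣) (above y) n else + 0)
  S-snoc A φ n = begin
    ∑ (words (suc n) V) (weight A φ)
      ≡⟨ words-snoc n V (weight A φ) ⟩
    ∑ (words n V) (λ r → ∑ V (λ y → weight A φ (r ++ y ∷ [])))
      ≡⟨ words-cong n V (λ r |r| _ → ∑-cong V (λ y → weight-snoc A φ n r y |r|)) ⟩
    ∑ (words n V) (λ r → ∑ V (λ y → G y r))
      ≡⟨ ∑-swap (words n V) V (λ r y → G y r) ⟩
    ∑ V (λ y → ∑ (words n V) (G y))
      ≡⟨ ∑-cong V pull-out ⟩
    ∑ V (λ y → if A ∣ y ∣ then lastFactor φ n y * S (remove A ∣ y ∣) (above y) n else + 0)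
      ∎
    where
    open ≡-Reasoning
    G : ℤ → List ℤ → ℤ
    G y r = if A ∣ y ∣ then lastFactor φ n y * weight (remove A ∣ y ∣) (above y) r else + 0
    pull-out : ∀ y → ∑ (words n V) (G y) ≡ (if A ∣ y ∣ then lastFactor φ n y * S (remove A ∣ y ∣) (above y) n else + 0)
    pull-out y with A ∣ y ∣
    ... | true  = ∑-*ˡ (words n V) (lastFactor φ n y) (weight (remove A ∣ y ∣) (above y))
    ... | false = ∑-zero (words n V)

  pair : NatSet → (ℤ → Bool) → ℕ → ℕ → ℤ
  pair A φ n a' = lastFactor φ n -[1+ a' ] * S (remove A (suc a')) (above -[1+ a' ]) n
                + lastFactor φ n (+ suc a') * S (remove A (suc a')) (above (+ suc a')) n

  S-by-rank : ∀ A φ n (H : ℕ → ℤ) →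
    (∀ a' → A (suc a') ≡ true → a' < d → pair A φ n a' ≡ H (size A a')) →
    S A φ (suc n) ≡ ∑< (size A d) H
  S-by-rank A φ n H pair≡H = begin
    S A φ (suc n)                                   ≡⟨ S-snoc A φ n ⟩
    ∑ V G                                           ≡⟨ ∑-signedVals d G ⟩
    ∑< d (λ a' → G -[1+ a' ] + G (+ suc a'))        ≡⟨ ∑<-cong d by-letter ⟩
    ∑< d (λ a' → if A (suc a') then H (size A a') else + 0) ≡⟨ ∑-by-rank A H d ⟩
    ∑< (size A d) H                                 ∎
    where
    open ≡-Reasoning
    G : ℤ → ℤ
    G y = if A ∣ y ∣ then lastFactor φ n y * S (remove A ∣ y ∣) (above y) n else + 0
    by-letter : ∀ a' → a' < d → G -[1+ a' ] + G (+ suc a') ≡ (if A (suc a') then H (size A a') else + 0)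
    by-letter a' a'<d with A (suc a') in Aa
    ... | true  = pair≡H a' Aa a'<d
    ... | false = refl

  Cpos : ℕ → ℕ → ℤ
  Cpos n α = qFact n t * (+ 1 + z) ^ α * (t + z) ^ (n ∸ α)

  Cneg : ℕ → ℕ → ℤ
  Cneg n β = qFact n t * t ^ β * (+ 1 + z) ^ β * (t + z) ^ (n ∸ β)

  pair-closed : ∀ A φ n a' → let j = size A a' in
    S (remove A (suc a')) (above -[1+ a' ]) n ≡ Cneg n j →
    S (remove A (suc a')) (above (+ suc a')) n ≡ Cpos n j →
    pair A φ n a' ≡ qFact n t * (coeff (suc n) j *
      (z * (if φ -[1+ a' ] then t ^ suc n else + 1) * t ^ j + (if φ (+ suc a') then t ^ suc n else + 1)))
  pair-closed A φ n a' Sneg Spos =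
    trans (cong₂ (λ m p → z * + 1 * Fneg * m + + 1 * Fpos * p) Sneg Spos)
          (collect z (qFact n t) (t ^ j) ((+ 1 + z) ^ j) ((t + z) ^ (n ∸ j)) Fneg Fpos)
    where
    j : ℕ
    j = size A a'
    Fneg Fpos : ℤ
    Fneg = if φ -[1+ a' ] then t ^ suc n else + 1
    Fpos = if φ (+ suc a') then t ^ suc n else + 1
    collect : ∀ z q P X Y B C → z * + 1 * B * (q * P * X * Y) + + 1 * C * (q * X * Y) ≡ q * (X * Y * (z * B * P + C))
    collect = solve-∀

  S-factor : ∀ A φ n (T : ℕ → ℤ) → size A d ≡ suc n →
    (∀ a' → A (suc a') ≡ true → a' < d → pair A φ n a' ≡ qFact n t * T (size A a')) →
    S A φ (suc n) ≡ qFact n t * ∑< (suc n) T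
  S-factor A φ n T |A| pair≡T = begin
    S A φ (suc n)                         ≡⟨ S-by-rank A φ n (λ j → qFact n t * T j) pair≡T ⟩
    ∑< (size A d) (λ j → qFact n t * T j) ≡⟨ cong (λ c → ∑< c (λ j → qFact n t * T j)) |A| ⟩
    ∑< (suc n) (λ j → qFact n t * T j)    ≡⟨ ∑<-*ˡ (suc n) (qFact n t) T ⟩
    qFact n t * ∑< (suc n) T              ∎
    where open ≡-Reasoning

  -- By induction on n: S-factor reduces it to sum-pos and sum-neg.
  closed-form : ∀ n A u' → size A d ≡ n → A (suc u') ≡ false → u' < d →
    (S A (above (+ suc u')) n ≡ Cpos n (size A u')) × (S A (above -[1+ u' ]) n ≡ Cneg n (size A u'))

  -- The case used in the recursion: u = a after removing a from A, which keeps its rank.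
  closed-form-removed : ∀ n A a' → size A d ≡ suc n → A (suc a') ≡ true → a' < d →
    (S (remove A (suc a')) (above (+ suc a')) n ≡ Cpos n (size A a')) ×
    (S (remove A (suc a')) (above -[1+ a' ]) n ≡ Cneg n (size A a'))
  closed-form-removed n A a' |A| Aa a'<d =
    subst (λ j → (S A′ (above (+ suc a')) n ≡ Cpos n j) × (S A′ (above -[1+ a' ]) n ≡ Cneg n j))
          (size-remove-below A (suc a') a' (ℕP.n<1+n a'))
          (closed-form n A′ a' (ℕP.suc-injective (trans (size-remove A (suc a') d (s≤s z≤n) a'<d Aa) |A|))
                       (remove-self A (suc a')) a'<d)
    where
    A′ : NatSet
    A′ = remove A (suc a')

  closed-form zero A u' |A| Au u'<d
    rewrite ℕP.n≤0⇒n≡0 (subst (size A u' ≤_) |A| (size-mono A (ℕP.<⇒≤ u'<d))) = refl , refl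
  closed-form (suc n) A u' |A| Au u'<d = positive , negative
    where
    open ≡-Reasoning
    α : ℕ
    α = size A u'
    α≤1+n : α ≤ suc n
    α≤1+n = subst (α ≤_) |A| (size-mono A (ℕP.<⇒≤ u'<d))
    lift-qFact : ∀ m X → qFact n t * (Q (suc n) * m) * X ≡ qFact (suc n) t * m * X
    lift-qFact m X = begin
      qFact n t * (Q (suc n) * m) * X   ≡⟨ cong (_* X) (sym (ℤP.*-assoc (qFact n t) (Q (suc n)) m)) ⟩
      qFact n t * Q (suc n) * m * X     ≡⟨ cong (λ q → q * m * X) (sym (qFact-suc n t)) ⟩
      qFact (suc n) t * m * X           ∎

    positive : S A (above (+ suc u')) (suc n) ≡ Cpos (suc n) α
    positive = begin
      S A (above (+ suc u')) (suc n)
        ≡⟨ S-factor A (above (+ suc u')) n (posTerm (suc n) α) |A| pair-pos ⟩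
      qFact n t * ∑< (suc n) (posTerm (suc n) α)
        ≡⟨ cong (qFact n t *_) (sum-pos (suc n) α α≤1+n) ⟩
      qFact n t * (Q (suc n) * (+ 1 + z) ^ α * (t + z) ^ (suc n ∸ α))
        ≡⟨ sym (ℤP.*-assoc (qFact n t) _ _) ⟩
      qFact n t * (Q (suc n) * (+ 1 + z) ^ α) * (t + z) ^ (suc n ∸ α)
        ≡⟨ lift-qFact ((+ 1 + z) ^ α) ((t + z) ^ (suc n ∸ α)) ⟩
      Cpos (suc n) α
        ∎
      where
      pair-pos : ∀ a' → A (suc a') ≡ true → a' < d →
        pair A (above (+ suc u')) n a' ≡ qFact n t * posTerm (suc n) α (size A a')
      pair-pos a' Aa a'<d with closed-form-removed n A a' |A| Aa a'<d
      ... | Spos , Sneg =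
        trans (pair-closed A (above (+ suc u')) n a' Sneg Spos)
              (cong₂ (λ c b → qFact n t * (coeff (suc n) (size A a') * (c * t ^ size A a' + (if b then t ^ suc n else + 1))))
                     (ℤP.*-identityʳ z) (rank-pos A Aa Au))

    negative : S A (above -[1+ u' ]) (suc n) ≡ Cneg (suc n) α
    negative = begin
      S A (above -[1+ u' ]) (suc n)
        ≡⟨ S-factor A (above -[1+ u' ]) n (negTerm (suc n) α) |A| pair-neg ⟩
      qFact n t * ∑< (suc n) (negTerm (suc n) α)
        ≡⟨ cong (qFact n t *_) (sum-neg (suc n) α α≤1+n) ⟩
      qFact n t * (Q (suc n) * t ^ α * (+ 1 + z) ^ α * (t + z) ^ (suc n ∸ α))
        ≡⟨ reassoc (qFact n t) (Q (suc n)) (t ^ α) ((+ 1 + z) ^ α) ((t + z) ^ (suc n ∸ α)) ⟩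
      qFact n t * (Q (suc n) * (t ^ α * (+ 1 + z) ^ α)) * (t + z) ^ (suc n ∸ α)
        ≡⟨ lift-qFact (t ^ α * (+ 1 + z) ^ α) ((t + z) ^ (suc n ∸ α)) ⟩
      qFact (suc n) t * (t ^ α * (+ 1 + z) ^ α) * (t + z) ^ (suc n ∸ α)
        ≡⟨ cong (_* (t + z) ^ (suc n ∸ α)) (sym (ℤP.*-assoc (qFact (suc n) t) (t ^ α) ((+ 1 + z) ^ α))) ⟩
      Cneg (suc n) α
        ∎
      where
      reassoc : ∀ q Q P X Y → q * (Q * P * X * Y) ≡ q * (Q * (P * X)) * Y
      reassoc = solve-∀
      pair-neg : ∀ a' → A (suc a') ≡ true → a' < d →
        pair A (above -[1+ u' ]) n a' ≡ qFact n t * negTerm (suc n) α (size A a')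
      pair-neg a' Aa a'<d with closed-form-removed n A a' |A| Aa a'<d
      ... | Spos , Sneg =
        trans (pair-closed A (above -[1+ u' ]) n a' Sneg Spos)
              (cong (λ b → qFact n t * (coeff (suc n) (size A a') * (z * (if b then t ^ suc n else + 1) * t ^ size A a' + t ^ suc n)))
                    (rank-neg A Aa Au))

  S-full : ∀ n → d ≡ suc n → S full never d ≡ qFact d t * (+ 1 + z) ^ d
  S-full n refl = begin
    S full never (suc n)
      ≡⟨ S-factor full never n (λ j → coeff (suc n) j * (z * t ^ j + + 1)) (size-full d) pair-full ⟩
    qFact n t * ∑< (suc n) (λ j → coeff (suc n) j * (z * t ^ j + + 1))
      ≡⟨ cong (qFact n t *_) (sum-free (suc n)) ⟩
    qFact n t * (Q (suc n) * (+ 1 + z) ^ suc n)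
      ≡⟨ sym (ℤP.*-assoc (qFact n t) (Q (suc n)) _) ⟩
    qFact n t * Q (suc n) * (+ 1 + z) ^ suc n
      ≡⟨ cong (_* (+ 1 + z) ^ suc n) (sym (qFact-suc n t)) ⟩
    qFact (suc n) t * (+ 1 + z) ^ suc n
      ∎
    where
    open ≡-Reasoning
    pair-full : ∀ a' → full (suc a') ≡ true → a' < suc n →
      pair full never n a' ≡ qFact n t * (coeff (suc n) (size full a') * (z * t ^ size full a' + + 1))
    pair-full a' _ a'<d with closed-form-removed n full a' (size-full d) refl a'<d
    ... | Spos , Sneg =
      trans (pair-closed full never n a' Sneg Spos)
            (cong (λ c → qFact n t * (coeff (suc n) (size full a') * (c * t ^ size full a' + + 1))) (ℤP.*-identityʳ z))

-- For a word w of length d over ±{1,…,d}, twice its contribution to Σ_{σ ∈ S_d^D} t^Wmaj(σ)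
-- is the sum of its weights at z = t and at z = -t: the sign (-1)^neg(w) selects S_d^D.
typeD-indicator : ∀ d t w → length w ≡ d → All (_∈ signedVals d) w →
  + 2 * (if does (inTypeD? d w) then t ^ Wmaj w else + 0) ≡
  Refined.weight d t t full never w + Refined.weight d t (- t) full never w
typeD-indicator d t w |w| w∈ rewrite fresh-full w with fresh full w in ok
... | false = refl
... | true rewrite inTypeD-sign d w ok |w| (Data.List.Relation.Unary.All.map (signedVals-InRange d _) w∈)
                 | lastSat-never w | ℤP.^-distribˡ-+-* t (maj w) (negCount w) | neg-^ t (negCount w)
                 with isEven (negCount w)
...   | true  = even (t ^ maj w) (t ^ negCount w)
  where
  even : ∀ (M N : ℤ) → + 2 * (M * N) ≡ M * N * + 1 + M * N * + 1
  even = solve-∀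
...   | false = odd (t ^ maj w) (t ^ negCount w)
  where
  odd : ∀ (M N : ℤ) → + 0 ≡ M * N * + 1 + M * (- N) * + 1
  odd = solve-∀

theorem4p1 : (d : ℕ) → 1 ≤ d → (t : ℤ) →
    + 2 * WmajGenD d t ≡ ((+ 1 - t) ^ d + (+ 1 + t) ^ d) * qFact d t
theorem4p1 (suc n) _ t = begin
  + 2 * WmajGenD d t
    ≡⟨ cong (+ 2 *_) (trans (foldr-map≡∑ (typeD d) _) (∑-filter (inTypeD? d) (words d V) _)) ⟩
  + 2 * ∑ (words d V) (λ w → if does (inTypeD? d w) then t ^ Wmaj w else + 0)
    ≡⟨ sym (∑-*ˡ (words d V) (+ 2) _) ⟩
  ∑ (words d V) (λ w → + 2 * (if does (inTypeD? d w) then t ^ Wmaj w else + 0))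
    ≡⟨ words-cong d V (typeD-indicator d t) ⟩
  ∑ (words d V) (λ w → Refined.weight d t t full never w + Refined.weight d t (- t) full never w)
    ≡⟨ ∑-+ (words d V) _ _ ⟩
  Refined.S d t t full never d + Refined.S d t (- t) full never d
    ≡⟨ cong₂ _+_ (Refined.S-full d t t n refl) (Refined.S-full d t (- t) n refl) ⟩
  qFact d t * (+ 1 + t) ^ d + qFact d t * (+ 1 - t) ^ d
    ≡⟨ factor (qFact d t) ((+ 1 + t) ^ d) ((+ 1 - t) ^ d) ⟩
  ((+ 1 - t) ^ d + (+ 1 + t) ^ d) * qFact d t
    ∎
  where
  open ≡-Reasoning
  d : ℕ
  d = suc n
  V : List ℤ
  V = signedVals d
  factor : ∀ q P M → q * P + q * M ≡ (M + P) * q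
  factor = solve-∀
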